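{- Let $k\ge1$ and let $R=\{v_1,\ldots,v_n\}$ be a set of $n$ binary $k$-mers (elements of $\{0,1\}^k$) such that $1^k:=(1,\ldots,1)\in R$. Let $C$ be the $n\times k$ matrix whose $i$-th row is $v_i$. Then $R$ is a resolving set of the hypercube $\mathbb{H}_{k,2}$ if and only if $\ker(C)\cap\{0,\pm1\}^k=\{0\}$.
   Context: The hypercube $\mathbb{H}_{k,2}$ has vertex set $\{0,1\}^k$, two vertices adjacent iff they differ in exactly one coordinate; its graph distance is the Hamming distance $d(u,v)$ (number of coordinates where $u,v$ differ). A non-empty set $R$ of vertices is resolving if for all vertices $u\ne v$ there is $r\in R$ with $d(u,r)\ne d(v,r)$. -}

module Defs where

open import Data.Nat using (ℕ; zero; suc; _+_)
open import Data.Bool using (Bool; true; false)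
open import Data.Integer using (ℤ; +_; -[1+_]; 0ℤ; 1ℤ; -1ℤ) renaming (_+_ to _+ℤ_; _*_ to _*ℤ_)
open import Data.Vec using (Vec; []; _∷_; replicate; zipWith; foldr; lookup; toList)
open import Data.Fin using (Fin)
open import Data.Product using (Σ; ∃; _×_; _,_)
open import Data.Sum using (_⊎_)
open import Relation.Binary.PropositionalEquality using (_≡_; _≢_)
open import Data.List.Membership.Propositional using (_∈_)

Vertex : ℕ → Set
Vertex k = Vec Bool k

-- Hamming distance (= graph distance in H_{k,2}).
hamming : ∀ {k} → Vertex k → Vertex k → ℕ
hamming [] [] = zero
hamming (true  ∷ u) (true  ∷ v) = hamming u v
hamming (false ∷ u) (false ∷ v) = hamming u v
hamming (true  ∷ u) (false ∷ v) = suc (hamming u v)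
hamming (false ∷ u) (true  ∷ v) = suc (hamming u v)

ones : ∀ k → Vertex k
ones k = replicate k true

-- R (given as a list of its n elements) is a resolving set of H_{k,2}:
-- non-empty, and every pair of distinct vertices is distinguished by some r ∈ R.
-- (Non-emptiness is implied here by 1^k ∈ R but stated for fidelity.)
Resolving : ∀ {k n} → Vec (Vertex k) n → Set
Resolving {k} {n} R =
  (Σ ℕ λ m → n ≡ suc m) ×
  (∀ (u v : Vertex k) → u ≢ v →
     ∃ λ r → (r ∈ toList R) × (hamming u r ≢ hamming v r))

bitℤ : Bool → ℤ
bitℤ true  = 1ℤ
bitℤ false = 0ℤ

dot : ∀ {k} → Vertex k → Vec ℤ k → ℤ
dot v x = foldr _ _+ℤ_ 0ℤ (zipWith (λ b z → bitℤ b *ℤ z) v x)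

InKernel : ∀ {k n} → Vec (Vertex k) n → Vec ℤ k → Set
InKernel {n = n} R x = ∀ (i : Fin n) → dot (lookup R i) x ≡ 0ℤ

Trit : ℤ → Set
Trit z = (z ≡ 0ℤ) ⊎ (z ≡ 1ℤ) ⊎ (z ≡ -1ℤ)

AllTrit : ∀ {k} → Vec ℤ k → Set
AllTrit [] = Data.Unit.⊤ where import Data.Unit
AllTrit (z ∷ x) = Trit z × AllTrit x

-- ker(C) ∩ {0,±1}^k = {0}  (0 is always in it, so this is the inclusion ⊆).
KernelTritTrivial : ∀ {k n} → Vec (Vertex k) n → Set
KernelTritTrivial {k} R =
  ∀ (x : Vec ℤ k) → AllTrit x → InKernel R x → x ≡ replicate k 0ℤ

-- Write x = u − v ∈ {0,±1}^k for vertices u, v. Coordinatewise one checks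
--   d(u,r) + 2⟨r,x⟩ = d(v,r) + ⟨1^k,x⟩,
-- so taking r = 1^k gives d(u,1^k) + ⟨1^k,x⟩ = d(v,1^k). Hence if 1^k ∈ R, then
-- u and v are at equal distance from every r ∈ R iff Cx = 0. Since every
-- vector of {0,±1}^k is such a difference, and x = 0 iff u = v, "R separates
-- all pairs of vertices" and "ker C meets {0,±1}^k only in 0" are the same
-- statement.
module Submission where

open import Defs
open import Data.Nat using (ℕ; suc; _≥_) renaming (_≟_ to _≟ℕ_)
open import Data.Bool using (Bool; true; false) renaming (_≟_ to _≟𝔹_)
open import Data.Integer using (ℤ; +_; 0ℤ; 1ℤ; _+_; _-_; _*_)
import Data.Integer.Properties as ℤ
open import Algebra.Properties.AbelianGroup ℤ.+-0-abelianGroup using (∙-cancelˡ; ∙-cancelʳ)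
open import Algebra.Properties.CommutativeSemigroup ℤ.+-commutativeSemigroup using (interchange)
open import Data.Vec using (Vec; []; _∷_; replicate; zipWith; toList; lookup)
open import Data.Vec.Properties using (∷-injectiveʳ; ≡-dec)
open import Data.Vec.Membership.Propositional.Properties using (∈-lookup; ∈-toList⁺)
open import Data.Fin using (zero; suc)
open import Data.List.Relation.Unary.All as All using (All; []; _∷_)
open import Data.List.Relation.Unary.All.Properties using (¬All⇒Any¬)
open import Data.List.Membership.Propositional using (_∈_; find)
open import Data.Product using (Σ; ∃₂; _,_)
open import Data.Sum using (inj₁; inj₂)
open import Function using (_∘_)
open import Function.Bundles using (_⇔_; mk⇔; Equivalence)
open import Function.Definitions using (Injective)
open import Function.Construct.Composition using (_⇔-∘_)
open import Function.Construct.Symmetry using (⇔-sym)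
open import Relation.Nullary.Decidable using (decidable-stable)
open import Relation.Binary.PropositionalEquality
  using (_≡_; refl; sym; trans; cong; cong₂; subst; module ≡-Reasoning)

private
  variable
    k n : ℕ

bitDiff : Vertex k → Vertex k → Vec ℤ k
bitDiff = zipWith (λ a b → bitℤ a - bitℤ b)

Equidistant : Vec (Vertex k) n → Vertex k → Vertex k → Set
Equidistant R u v = All (λ r → hamming u r ≡ hamming v r) (toList R)

hamming-∷ : ∀ a b (u v : Vertex k) →
  + hamming (a ∷ u) (b ∷ v) ≡ + hamming (a ∷ []) (b ∷ []) + + hamming u v
hamming-∷ true  true  u v = refl
hamming-∷ true  false u v = refl
hamming-∷ false true  u v = refl
hamming-∷ false false u v = refl

hamming-bitDiff-bit : ∀ a b c →
  let e = bitℤ c * (bitℤ a - bitℤ b) in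
  + hamming (a ∷ []) (c ∷ []) + (e + e) ≡ + hamming (b ∷ []) (c ∷ []) + 1ℤ * (bitℤ a - bitℤ b)
hamming-bitDiff-bit true  true  true  = refl
hamming-bitDiff-bit true  true  false = refl
hamming-bitDiff-bit true  false true  = refl
hamming-bitDiff-bit true  false false = refl
hamming-bitDiff-bit false true  true  = refl
hamming-bitDiff-bit false true  false = refl
hamming-bitDiff-bit false false true  = refl
hamming-bitDiff-bit false false false = refl

hamming-bitDiff : (u v r : Vertex k) →
  let x = bitDiff u v in
  + hamming u r + (dot r x + dot r x) ≡ + hamming v r + dot (ones k) x
hamming-bitDiff []      []      []      = refl
hamming-bitDiff (a ∷ u) (b ∷ v) (c ∷ r) = begin
  + hamming (a ∷ u) (c ∷ r) + ((e + D) + (e + D))  ≡⟨ cong₂ _+_ (hamming-∷ a c u r) (interchange e D e D) ⟩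
  (hac + + hamming u r) + ((e + e) + (D + D))      ≡⟨ interchange hac (+ hamming u r) (e + e) (D + D) ⟩
  (hac + (e + e)) + (+ hamming u r + (D + D))      ≡⟨ cong₂ _+_ (hamming-bitDiff-bit a b c) (hamming-bitDiff u v r) ⟩
  (hbc + f) + (+ hamming v r + S)                  ≡⟨ interchange hbc f (+ hamming v r) S ⟩
  (hbc + + hamming v r) + (f + S)                  ≡⟨ cong (_+ (f + S)) (hamming-∷ b c v r) ⟨
  + hamming (b ∷ v) (c ∷ r) + (f + S)              ∎
  where
  open ≡-Reasoning
  e = bitℤ c * (bitℤ a - bitℤ b)
  f = 1ℤ * (bitℤ a - bitℤ b)
  D = dot r (bitDiff u v)
  S = dot (ones _) (bitDiff u v)
  hac = + hamming (a ∷ []) (c ∷ [])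
  hbc = + hamming (b ∷ []) (c ∷ [])

hamming-ones-bitDiff : (u v : Vertex k) →
  + hamming u (ones k) + dot (ones k) (bitDiff u v) ≡ + hamming v (ones k)
hamming-ones-bitDiff {k} u v = ∙-cancelʳ S (+ hamming u (ones k) + S) (+ hamming v (ones k)) (begin
  (+ hamming u (ones k) + S) + S  ≡⟨ ℤ.+-assoc (+ hamming u (ones k)) S S ⟩
  + hamming u (ones k) + (S + S)  ≡⟨ hamming-bitDiff u v (ones k) ⟩
  + hamming v (ones k) + S        ∎)
  where
  open ≡-Reasoning
  S = dot (ones k) (bitDiff u v)

equidistant-ones⇒dot-ones≡0 : (u v : Vertex k) →
  hamming u (ones k) ≡ hamming v (ones k) → dot (ones k) (bitDiff u v) ≡ 0ℤ
equidistant-ones⇒dot-ones≡0 {k} u v eq = ∙-cancelˡ (+ hamming u (ones k)) _ 0ℤ (begin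
  + hamming u (ones k) + dot (ones k) (bitDiff u v)  ≡⟨ hamming-ones-bitDiff u v ⟩
  + hamming v (ones k)                               ≡⟨ cong +_ eq ⟨
  + hamming u (ones k)                               ≡⟨ ℤ.+-identityʳ _ ⟨
  + hamming u (ones k) + 0ℤ                          ∎)
  where open ≡-Reasoning

double≡0⇒≡0 : ∀ d → d + d ≡ 0ℤ → d ≡ 0ℤ
double≡0⇒≡0 (+ 0) _ = refl

-- Once u and v have the same weight, d(u,r) − d(v,r) = −2⟨r, u − v⟩.
equidistant⇔orthogonal : (u v r : Vertex k) → dot (ones k) (bitDiff u v) ≡ 0ℤ →
  (hamming u r ≡ hamming v r) ⇔ (dot r (bitDiff u v) ≡ 0ℤ)
equidistant⇔orthogonal u v r S≡0 = mk⇔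
  (λ eq → double≡0⇒≡0 D (∙-cancelˡ (+ hamming u r) (D + D) 0ℤ
    (trans balanced (trans (cong +_ (sym eq)) (sym (ℤ.+-identityʳ _))))))
  (λ D≡0 → ℤ.+-injective (begin
    + hamming u r               ≡⟨ ℤ.+-identityʳ _ ⟨
    + hamming u r + (0ℤ + 0ℤ)   ≡⟨ cong (λ d → + hamming u r + (d + d)) D≡0 ⟨
    + hamming u r + (D + D)     ≡⟨ balanced ⟩
    + hamming v r               ∎))
  where
  open ≡-Reasoning
  D = dot r (bitDiff u v)
  balanced : + hamming u r + (D + D) ≡ + hamming v r
  balanced = trans (hamming-bitDiff u v r) (trans (cong (_+_ (+ hamming v r)) S≡0) (ℤ.+-identityʳ _))

InKernel⇔All : (R : Vec (Vertex k) n) (x : Vec ℤ k) →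
  InKernel R x ⇔ All (λ r → dot r x ≡ 0ℤ) (toList R)
InKernel⇔All {k} R x = mk⇔ (to R) (λ all i → All.lookup all (∈-toList⁺ (∈-lookup i R)))
  where
  to : ∀ {m} (R : Vec (Vertex k) m) → InKernel R x → All (λ r → dot r x ≡ 0ℤ) (toList R)
  to []      _   = []
  to (_ ∷ R) ker = ker zero ∷ to R (ker ∘ suc)

kernel⇔equidistant : (R : Vec (Vertex k) n) → ones k ∈ toList R → (u v : Vertex k) →
  InKernel R (bitDiff u v) ⇔ Equidistant R u v
kernel⇔equidistant {k} R ones∈R u v = mk⇔
  (λ ker → let orthogonal = Equivalence.to (InKernel⇔All R x) ker in
    All.map (Equivalence.from (pointwise (All.lookup orthogonal ones∈R))) orthogonal)
  (λ equi → Equivalence.from (InKernel⇔All R x)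
    (All.map (Equivalence.to (pointwise (equidistant-ones⇒dot-ones≡0 u v (All.lookup equi ones∈R)))) equi))
  where
  x = bitDiff u v
  pointwise : dot (ones k) x ≡ 0ℤ → ∀ {r} → (hamming u r ≡ hamming v r) ⇔ (dot r x ≡ 0ℤ)
  pointwise S≡0 {r} = equidistant⇔orthogonal u v r S≡0

bitDiff-trit : ∀ a b → Trit (bitℤ a - bitℤ b)
bitDiff-trit true  true  = inj₁ refl
bitDiff-trit true  false = inj₂ (inj₁ refl)
bitDiff-trit false true  = inj₂ (inj₂ refl)
bitDiff-trit false false = inj₁ refl

AllTrit-bitDiff : (u v : Vertex k) → AllTrit (bitDiff u v)
AllTrit-bitDiff []      []      = _
AllTrit-bitDiff (a ∷ u) (b ∷ v) = bitDiff-trit a b , AllTrit-bitDiff u v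

trit⇒bitDiff : ∀ {z} → Trit z → Σ Bool λ a → Σ Bool λ b → bitℤ a - bitℤ b ≡ z
trit⇒bitDiff (inj₁ refl)        = false , false , refl
trit⇒bitDiff (inj₂ (inj₁ refl)) = true  , false , refl
trit⇒bitDiff (inj₂ (inj₂ refl)) = false , true  , refl

AllTrit⇒bitDiff : (x : Vec ℤ k) → AllTrit x → ∃₂ λ u v → bitDiff u v ≡ x
AllTrit⇒bitDiff []      _          = [] , [] , refl
AllTrit⇒bitDiff (z ∷ x) (tz , tx) with trit⇒bitDiff tz | AllTrit⇒bitDiff x tx
... | a , b , refl | u , v , refl = a ∷ u , b ∷ v , refl

bitDiff≡0⇔≡ : (u v : Vertex k) → (bitDiff u v ≡ replicate k 0ℤ) ⇔ (u ≡ v)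
bitDiff≡0⇔≡ u v = mk⇔ (to u v) λ { refl → self u }
  where
  to : ∀ {k} (u v : Vertex k) → bitDiff u v ≡ replicate k 0ℤ → u ≡ v
  to []          []          _  = refl
  to (true  ∷ u) (true  ∷ v) eq = cong (true  ∷_) (to u v (∷-injectiveʳ eq))
  to (false ∷ u) (false ∷ v) eq = cong (false ∷_) (to u v (∷-injectiveʳ eq))
  to (true  ∷ u) (false ∷ v) ()
  to (false ∷ u) (true  ∷ v) ()
  self : ∀ {k} (u : Vertex k) → bitDiff u u ≡ replicate k 0ℤ
  self []      = refl
  self (a ∷ u) = cong₂ _∷_ (ℤ.+-inverseʳ (bitℤ a)) (self u)

KernelTritTrivial⇔kernel-bitDiff⇒≡ : (R : Vec (Vertex k) n) →
  KernelTritTrivial R ⇔ (∀ u v → InKernel R (bitDiff u v) → u ≡ v)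
KernelTritTrivial⇔kernel-bitDiff⇒≡ R = mk⇔
  (λ trivial u v ker → Equivalence.to (bitDiff≡0⇔≡ u v) (trivial _ (AllTrit-bitDiff u v) ker))
  (λ separates x tx ker → let (u , v , u-v≡x) = AllTrit⇒bitDiff x tx in
    trans (sym u-v≡x) (Equivalence.from (bitDiff≡0⇔≡ u v)
      (separates u v (subst (InKernel R) (sym u-v≡x) ker))))

Resolving⇔Equidistant⇒≡ : (R : Vec (Vertex k) n) → (Σ ℕ λ m → n ≡ suc m) →
  Resolving R ⇔ (∀ u v → Equidistant R u v → u ≡ v)
Resolving⇔Equidistant⇒≡ R nonempty = mk⇔ to from
  where
  to : Resolving R → ∀ u v → Equidistant R u v → u ≡ v
  to (_ , resolves) u v equi = decidable-stable (≡-dec _≟𝔹_ u v) λ u≢v →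
    let (_ , r∈R , distinguishes) = resolves u v u≢v in distinguishes (All.lookup equi r∈R)
  from : (∀ u v → Equidistant R u v → u ≡ v) → Resolving R
  from separates = nonempty , λ u v u≢v →
    find (¬All⇒Any¬ (λ r → hamming u r ≟ℕ hamming v r) (toList R) (u≢v ∘ separates u v))

∈-toList⇒nonempty : {R : Vec (Vertex k) n} {r : Vertex k} → r ∈ toList R → Σ ℕ λ m → n ≡ suc m
∈-toList⇒nonempty {R = _ ∷ _} _ = _ , refl

corollary2p4 : ∀ (k n : ℕ) → k ≥ 1 → (R : Vec (Vertex k) n) →
    Injective _≡_ _≡_ (lookup R) →
    ones k ∈ toList R →
    Resolving R ⇔ KernelTritTrivial R
corollary2p4 k n _ R _ ones∈R =
  ⇔-sym (KernelTritTrivial⇔kernel-bitDiff⇒≡ R) ⇔-∘ (separation ⇔-∘ Resolving⇔Equidistant⇒≡ R (∈-toList⇒nonempty ones∈R))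
  where
  separation : (∀ u v → Equidistant R u v → u ≡ v) ⇔ (∀ u v → InKernel R (bitDiff u v) → u ≡ v)
  separation = mk⇔
    (λ sep u v → sep u v ∘ Equivalence.to (kernel⇔equidistant R ones∈R u v))
    (λ sep u v → sep u v ∘ Equivalence.from (kernel⇔equidistant R ones∈R u v))
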